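{- For every prime power $q$ and every $n \in \mathbb{N}$, we have $h_q(n) \leq \lfloor \log_q(n) \rfloor$.
   Context: For a prime power $q$ and $n \in \mathbb{N}$, let $\sigma:\mathbb{F}_q^n\to\mathbb{F}_q^n$ be the cyclic shift $\sigma(\sum_{i=1}^n x_i e_i)=\sum_{i=1}^n x_{i-1}e_i$ (indices mod $n$), where $e_1,\dots,e_n$ is the standard basis. A subspace $U\le \mathbb{F}_q^n$ is cyclically covering if $\bigcup_{r=0}^{n-1}\sigma^r(U)=\mathbb{F}_q^n$. $h_q(n)$ denotes the maximum possible codimension of a cyclically covering subspace of $\mathbb{F}_q^n$. -}

module Defs where

open import Level using (Level; _⊔_)
open import Data.Nat using (ℕ; zero; suc; _≤?_; _∸_; _≤_; _<_)
open import Data.Nat.DivMod using (_/_)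
open import Data.Fin using (Fin; zero; suc; fromℕ; inject₁)
open import Data.Product using (Σ; ∃; _×_; _,_)
open import Relation.Binary.PropositionalEquality using (_≡_)
open import Relation.Nullary using (¬_; yes; no)
open import Algebra.Bundles using (CommutativeRing)

-- floor of log base b of n (b ≥ 2); convention: value 0 if n < b (incl. n = 0),
-- and 0 for the degenerate bases b ∈ {0,1} (never used).
-- The fuel n suffices since n / b < n.
flogAux : ℕ → ℕ → ℕ → ℕ
flogAux zero _ _ = 0
flogAux (suc zero) _ _ = 0
flogAux (suc (suc k)) zero n = 0
flogAux (suc (suc k)) (suc fuel) n with suc (suc k) ≤? n
... | yes _ = suc (flogAux (suc (suc k)) fuel (n / suc (suc k)))
... | no _ = 0

⌊log_⌋ : ℕ → ℕ → ℕ
⌊log b ⌋ n = flogAux b n n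

record Field (c ℓ : Level) : Set (Level.suc (c ⊔ ℓ)) where
  field
    commRing : CommutativeRing c ℓ
  open CommutativeRing commRing public
  field
    1≉0 : ¬ (1# ≈ 0#)
    inverse : ∀ x → ¬ (x ≈ 0#) → ∃ λ y → (x * y) ≈ 1#

record HasCard {c ℓ} (F : Field c ℓ) (q : ℕ) : Set (c ⊔ ℓ) where
  open Field F using (Carrier; _≈_; _+_; _*_; 0#; 1#)
  field
    enum : Fin q → Carrier
    enum-inj : ∀ i j → enum i ≈ enum j → i ≡ j
    enum-surj : ∀ x → ∃ λ i → enum i ≈ x

module LinAlg {c ℓ} (F : Field c ℓ) where
  open Field F using (Carrier; _≈_; _+_; _*_; 0#; 1#)

  Vec : ℕ → Set c
  Vec n = Fin n → Carrier

  _≋_ : ∀ {n} → Vec n → Vec n → Set ℓ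
  u ≋ v = ∀ i → u i ≈ v i

  zeroV : ∀ {n} → Vec n
  zeroV _ = 0#

  _⊕_ : ∀ {n} → Vec n → Vec n → Vec n
  (u ⊕ v) i = u i + v i

  _⊙_ : ∀ {n} → Carrier → Vec n → Vec n
  (a ⊙ v) i = a * v i

  ∑ : ∀ {d} → (Fin d → Carrier) → Carrier
  ∑ {zero} f = 0#
  ∑ {suc d} f = f zero + ∑ (λ i → f (suc i))

  lincomb : ∀ {n d} → (Fin d → Carrier) → (Fin d → Vec n) → Vec n
  lincomb c v j = ∑ (λ i → c i * v i j)

  record IsSubspace {n : ℕ} {p : Level} (U : Vec n → Set p) : Set (c ⊔ ℓ ⊔ p) where
    field
      resp : ∀ {u v} → u ≋ v → U u → U v
      has-zero : U zeroV
      closed-+ : ∀ {u v} → U u → U v → U (u ⊕ v)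
      closed-* : ∀ a {u} → U u → U (a ⊙ u)

  LinIndep : ∀ {n d} → (Fin d → Vec n) → Set (c ⊔ ℓ)
  LinIndep v = ∀ a → lincomb a v ≋ zeroV → ∀ i → a i ≈ 0#

  record IsBasis {n d : ℕ} {p : Level} (U : Vec n → Set p) (v : Fin d → Vec n) : Set (c ⊔ ℓ ⊔ p) where
    field
      indep : LinIndep v
      inU : ∀ i → U (v i)
      spans : ∀ u → U u → ∃ λ a → u ≋ lincomb a v

  HasDim : ∀ {n p} → (Vec n → Set p) → ℕ → Set (c ⊔ ℓ ⊔ p)
  HasDim {n} U d = Σ (Fin d → Vec n) λ v → IsBasis U v

  -- cyclic shift σ: (σ x)_i = x_{i-1}, indices mod n (0-indexed here)
  σ : ∀ {n} → Vec n → Vec n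
  σ {zero} x ()
  σ {suc m} x zero = x (fromℕ m)
  σ {suc m} x (suc i) = x (inject₁ i)

  σ^ : ∀ {n} → ℕ → Vec n → Vec n
  σ^ zero x = x
  σ^ (suc r) x = σ (σ^ r x)

  CyclicallyCovering : ∀ {n p} → (Vec n → Set p) → Set (c ⊔ ℓ ⊔ p)
  CyclicallyCovering {n} U = ∀ x → ∃ λ r → r < n × ∃ λ u → U u × σ^ r u ≋ x

-- Every x ∈ F_q^n can be written as σ^r(∑ a_i v_i) with
-- 0 ≤ r < n and a ∈ F_q^d, so the map (r, a) ↦ σ^r(∑ a_i v_i) from a set of size n·q^d onto
-- F_q^n gives q^n ≤ n·q^d, that is q^(n-d) ≤ n, whence n - d ≤ ⌊log_q n⌋.
module Submission where

open import Defs
open import Data.Nat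
open import Data.Nat.Properties
open import Data.Nat.DivMod using (_/_; m/n<m; m*n/n≡m; /-monoˡ-≤)
open import Data.Fin as Fin using (Fin; zero; suc; toℕ; fromℕ<; combine; remQuot; finToFun; funToFin)
open import Data.Fin.Properties using (injective⇒≤; toℕ-fromℕ<; remQuot-combine; finToFun-funToFin; funToFin-finToFin)
open import Data.Product using (∃; _×_; _,_; proj₁; proj₂)
open import Function using (_∘_)
open import Data.Empty using (⊥-elim)
open import Relation.Binary.PropositionalEquality as ≡ using (_≡_; cong)
open import Relation.Nullary using (yes; no)

^≤⇒≤flogAux : ∀ b fuel {k m} → 2 ≤ b → m ≤ fuel → b ^ k ≤ m → k ≤ flogAux b fuel m
^≤⇒≤flogAux b fuel {zero} _ _ _ = z≤n
^≤⇒≤flogAux (suc zero) _ {suc _} (s≤s ()) _ _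
^≤⇒≤flogAux b@(suc (suc _)) zero {suc k} _ m≤0 bᵏ⁺¹≤m =
  ⊥-elim (<⇒≱ (m^n>0 b (suc k)) (≤-trans bᵏ⁺¹≤m m≤0))
^≤⇒≤flogAux b@(suc (suc _)) (suc fuel) {suc k} {m} 2≤b m≤1+fuel bᵏ⁺¹≤m with b ≤? m
... | no b≰m = ⊥-elim (b≰m (≤-trans (m≤m*n b (b ^ k) {{>-nonZero (m^n>0 b k)}}) bᵏ⁺¹≤m))
... | yes b≤m = s≤s (^≤⇒≤flogAux b fuel 2≤b m/b≤fuel bᵏ≤m/b)
  where
  instance
    m≢0 : NonZero m
    m≢0 = >-nonZero (≤-trans (s≤s z≤n) b≤m)
  m/b≤fuel : m / b ≤ fuel
  m/b≤fuel = s≤s⁻¹ (≤-trans (m/n<m m b 2≤b) m≤1+fuel)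
  bᵏ≤m/b : b ^ k ≤ m / b
  bᵏ≤m/b = begin
    b ^ k          ≡⟨ ≡.sym (m*n/n≡m (b ^ k) b) ⟩
    b ^ k * b / b  ≡⟨ cong (_/ b) (*-comm (b ^ k) b) ⟩
    b * b ^ k / b  ≤⟨ /-monoˡ-≤ b bᵏ⁺¹≤m ⟩
    m / b          ∎
    where open ≤-Reasoning

^≤⇒≤⌊log⌋ : ∀ b {k m} → 2 ≤ b → b ^ k ≤ m → k ≤ ⌊log b ⌋ m
^≤⇒≤⌊log⌋ b 2≤b = ^≤⇒≤flogAux b _ 2≤b ≤-refl

∸≤⌊log⌋ : ∀ b n d → 2 ≤ b → b ^ n ≤ n * b ^ d → n ∸ d ≤ ⌊log b ⌋ n
∸≤⌊log⌋ b n d 2≤b bⁿ≤n*bᵈ with n ≤? d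
... | yes n≤d rewrite m≤n⇒m∸n≡0 n≤d = z≤n
... | no n≰d = ^≤⇒≤⌊log⌋ b 2≤b (*-cancelˡ-≤ (b ^ d) {{bᵈ≢0}} (begin
    b ^ d * b ^ (n ∸ d)  ≡⟨ ≡.sym (^-distribˡ-+-* b d (n ∸ d)) ⟩
    b ^ (d + (n ∸ d))    ≡⟨ cong (b ^_) (m+[n∸m]≡n (<⇒≤ (≰⇒> n≰d))) ⟩
    b ^ n                ≤⟨ bⁿ≤n*bᵈ ⟩
    n * b ^ d            ≡⟨ *-comm n (b ^ d) ⟩
    b ^ d * n            ∎))
  where
  open ≤-Reasoning
  bᵈ≢0 : NonZero (b ^ d)
  bᵈ≢0 = >-nonZero (m^n>0 b {{>-nonZero (≤-trans (s≤s z≤n) 2≤b)}} d)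

funToFin-cong : ∀ {m n} {f g : Fin m → Fin n} → (∀ i → f i ≡ g i) → funToFin f ≡ funToFin g
funToFin-cong {zero} _ = ≡.refl
funToFin-cong {suc m} f≗g = ≡.cong₂ combine (f≗g zero) (funToFin-cong (λ i → f≗g (suc i)))

finToFun-injective : ∀ {m n} {k l : Fin (m ^ n)} → (∀ i → finToFun {m} {n} k i ≡ finToFun l i) → k ≡ l
finToFun-injective {m} {n} {k} {l} eq = begin
  k                                 ≡⟨ ≡.sym (funToFin-finToFin {n} {m} k) ⟩
  funToFin (finToFun {m} {n} k)     ≡⟨ funToFin-cong {n} {m} eq ⟩
  funToFin (finToFun {m} {n} l)     ≡⟨ funToFin-finToFin {n} {m} l ⟩
  l                                 ∎
  where open ≡.≡-Reasoning

card≥2 : ∀ {c ℓ} (F : Field c ℓ) {q} → HasCard F q → 2 ≤ q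
card≥2 F {zero} card with () ← HasCard.enum-surj card (Field.0# F)
card≥2 F {suc zero} card with HasCard.enum-surj card (Field.0# F) | HasCard.enum-surj card (Field.1# F)
... | zero , e0 | zero , e1 = ⊥-elim (Field.1≉0 F (Field.trans F (Field.sym F e1) e0))
card≥2 F {suc (suc q)} card = s≤s (s≤s z≤n)

module _ {c ℓ} (F : Field c ℓ) where
  open Field F using (Carrier; _≈_; refl; sym; trans; reflexive; +-cong; *-cong)
  open LinAlg F

  ≋-sym : ∀ {n} {u v : Vec n} → u ≋ v → v ≋ u
  ≋-sym u≋v i = sym (u≋v i)

  ≋-trans : ∀ {n} {u v w : Vec n} → u ≋ v → v ≋ w → u ≋ w
  ≋-trans u≋v v≋w i = trans (u≋v i) (v≋w i)

  σ-cong : ∀ {n} {u v : Vec n} → u ≋ v → σ u ≋ σ v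
  σ-cong {suc m} u≋v zero = u≋v (Fin.fromℕ m)
  σ-cong {suc m} u≋v (suc i) = u≋v (Fin.inject₁ i)

  σ^-cong : ∀ {n} r {u v : Vec n} → u ≋ v → σ^ r u ≋ σ^ r v
  σ^-cong zero u≋v = u≋v
  σ^-cong (suc r) u≋v = σ-cong (σ^-cong r u≋v)

  ∑-cong : ∀ {d} {f g : Fin d → Carrier} → (∀ i → f i ≈ g i) → ∑ f ≈ ∑ g
  ∑-cong {zero} _ = refl
  ∑-cong {suc d} f≈g = +-cong (f≈g zero) (∑-cong (λ i → f≈g (suc i)))

  lincomb-cong : ∀ {n d} {a b : Fin d → Carrier} (v : Fin d → Vec n) →
                 (∀ i → a i ≈ b i) → lincomb a v ≋ lincomb b v
  lincomb-cong v a≈b j = ∑-cong (λ i → *-cong (a≈b i) refl)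

  module _ {q} (card : HasCard F q) where
    open HasCard card

    onto⇒q^n≤ : ∀ {n m} (f : Fin m → Vec n) → (∀ x → ∃ λ i → f i ≋ x) → q ^ n ≤ m
    onto⇒q^n≤ {n} f f-onto = injective⇒≤ {f = preimage} preimage-injective
      where
      word : Fin (q ^ n) → Vec n
      word k i = enum (finToFun k i)
      preimage : Fin (q ^ n) → Fin _
      preimage k = proj₁ (f-onto (word k))
      preimage-injective : ∀ {k l} → preimage k ≡ preimage l → k ≡ l
      preimage-injective {k} {l} eq = finToFun-injective {q} {n} λ i → enum-inj _ _
        (trans (sym (proj₂ (f-onto (word k)) i))
        (trans (≡.subst (λ j → f (preimage k) i ≈ f j i) eq refl)
               (proj₂ (f-onto (word l)) i)))

    coefficientCode : ∀ {d} (a : Fin d → Carrier) → ∃ λ (code : Fin d → Fin q) → ∀ i → enum (code i) ≈ a i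
    coefficientCode a = (λ i → proj₁ (enum-surj (a i))) , (λ i → proj₂ (enum-surj (a i)))

    module _ {n d p} {U : Vec n → Set p} (v : Fin d → Vec n)
             (spans : ∀ u → U u → ∃ λ a → u ≋ lincomb a v) (covering : CyclicallyCovering U) where

      shiftedCombination : Fin n × Fin (q ^ d) → Vec n
      shiftedCombination (r , a) = σ^ (toℕ r) (lincomb (λ i → enum (finToFun a i)) v)

      shiftedCombination-onto : ∀ x → ∃ λ ra → shiftedCombination ra ≋ x
      shiftedCombination-onto x with covering x
      ... | r , r<n , u , Uu , σʳu≋x with spans u Uu
      ... | a , u≋∑av with coefficientCode a
      ... | code , enum∘code≈a = (fromℕ< r<n , funToFin code) , ≋-trans shifted≋σʳu σʳu≋x
        where
        enum∘code≈a′ : ∀ i → enum (finToFun (funToFin code) i) ≈ a i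
        enum∘code≈a′ i = trans (reflexive (cong enum (finToFun-funToFin code i))) (enum∘code≈a i)
        shifted≋σʳu : shiftedCombination (fromℕ< r<n , funToFin code) ≋ σ^ r u
        shifted≋σʳu rewrite toℕ-fromℕ< r<n =
          σ^-cong r (≋-trans (lincomb-cong v enum∘code≈a′) (≋-sym u≋∑av))

      q^n≤n*q^d : q ^ n ≤ n * q ^ d
      q^n≤n*q^d = onto⇒q^n≤ (shiftedCombination ∘ remQuot (q ^ d)) onto
        where
        onto : ∀ x → ∃ λ j → shiftedCombination (remQuot (q ^ d) j) ≋ x
        onto x with (r , a) , shifted≋x ← shiftedCombination-onto x =
          combine r a , ≡.subst (λ ra → shiftedCombination ra ≋ x) (≡.sym (remQuot-combine r a)) shifted≋x

lemma2p3 : ∀ {c ℓ} (F : Field c ℓ) (q : ℕ) → HasCard F q →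
           ∀ (n : ℕ) → 1 ≤ n →
           ∀ {p} (U : LinAlg.Vec F n → Set p) → LinAlg.IsSubspace F U →
           ∀ (d : ℕ) → LinAlg.HasDim F U d →
           LinAlg.CyclicallyCovering F U →
           n ∸ d ≤ ⌊log q ⌋ n
lemma2p3 F q card n _ U _ d (v , basis) covering =
  ∸≤⌊log⌋ q n d (card≥2 F card) (q^n≤n*q^d F card v (LinAlg.IsBasis.spans basis) covering)
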